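{- Let $n\ge4$ and let $G$ be a signed multigraph on $[n]$ with index of primitivity $k$. Then there exist a coboundary graph $F$ and a primitive signed multigraph $H$, both on $[n]$, such that $G=F+kH$.
   Context: A signed multigraph on $[n]$ is a symmetric matrix in $\mathbb{Z}^{n\times n}$ with zero diagonal. For $\sigma\in S_n$, $(G^\sigma)_{ij}=G_{\sigma(i)\sigma(j)}$. The index of primitivity of $G$ is $k=\gcd\{(G^\pi)_{13}-(G^\pi)_{23}-(G^\pi)_{14}+(G^\pi)_{24}:\pi\in S_n\}\ge0$, and $G$ is primitive if $k=1$. A coboundary graph is a matrix $\delta f$ with $(\delta f)_{ij}=f_i+f_j$ for $i\ne j$ and zero diagonal, where $f\in(\tfrac12\mathbb{Z})^n$ has entries either all in $\mathbb{Z}$ or all in $\tfrac12\mathbb{Z}\setminus\mathbb{Z}$. -}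

module Defs where

open import Data.Nat as ℕ using (ℕ; _≤_; _<_; s≤s; z≤n)
open import Data.Nat.Properties using (<-≤-trans)
open import Data.Nat.Divisibility using (_∣_)
open import Data.Integer as ℤ using (ℤ; +_; _+_; _-_; _*_; ∣_∣)
open import Data.Fin using (Fin; fromℕ<)
open import Data.Fin.Permutation using (Permutation′; _⟨$⟩ʳ_)
open import Data.Product using (Σ; _×_; ∃)
open import Data.Sum using (_⊎_)
open import Relation.Binary.PropositionalEquality using (_≡_; _≢_)

Matrix : ℕ → Set
Matrix n = Fin n → Fin n → ℤ

IsSignedMultigraph : ∀ {n} → Matrix n → Set
IsSignedMultigraph {n} G = (∀ i j → G i j ≡ G j i) × (∀ i → G i i ≡ + 0)

_^_ : ∀ {n} → Matrix n → Permutation′ n → Matrix n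
(G ^ σ) i j = G (σ ⟨$⟩ʳ i) (σ ⟨$⟩ʳ j)

-- vertices 1,2,3,4 of [n] (as Fin indices 0,1,2,3), for n ≥ 4
module _ {n : ℕ} (4≤n : 4 ≤ n) where
  v : (a : ℕ) → a < 4 → Fin n
  v a a<4 = fromℕ< (<-≤-trans a<4 4≤n)

  v1 v2 v3 v4 : Fin n
  v1 = v 0 (s≤s z≤n)
  v2 = v 1 (s≤s (s≤s z≤n))
  v3 = v 2 (s≤s (s≤s (s≤s z≤n)))
  v4 = v 3 (s≤s (s≤s (s≤s (s≤s z≤n))))

  quad : Matrix n → ℤ
  quad G = G v1 v3 - G v2 v3 - G v1 v4 + G v2 v4

  IsIndexOfPrimitivity : Matrix n → ℕ → Set
  IsIndexOfPrimitivity G k =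
    (∀ (π : Permutation′ n) → k ∣ ∣ quad (G ^ π) ∣) ×
    (∀ (d : ℕ) → (∀ (π : Permutation′ n) → d ∣ ∣ quad (G ^ π) ∣) → d ∣ k)

  IsPrimitive : Matrix n → Set
  IsPrimitive G = IsIndexOfPrimitivity G 1

Even Odd : ℤ → Set
Even x = ∃ λ a → x ≡ + 2 * a
Odd x = ∃ λ a → x ≡ + 2 * a + + 1

-- coboundary graph δf with f ∈ (½ℤ)^n, f all-integer or all-half-integer.
-- f is encoded by numerators g = 2f ∈ ℤ^n: f integral ⇔ g all even,
-- f strictly half-integral ⇔ g all odd.  (δf)_ij = f_i + f_j, i.e.
-- 2 (δf)_ij = g_i + g_j for i ≠ j, and zero diagonal.
IsCoboundary : ∀ {n} → Matrix n → Set
IsCoboundary {n} F = Σ (Fin n → ℤ) λ g →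
  ((∀ i → Even (g i)) ⊎ (∀ i → Odd (g i))) ×
  (∀ i j → i ≢ j → + 2 * F i j ≡ g i + g j) ×
  (∀ i → F i i ≡ + 0)

module Submission where

-- Fix the vertex o = v1 and let R i j = G i j − G o i − G o j; this removes from G the
-- coboundary of the row of o. An alternating sum G a c − G b c − G a d + G b d over four
-- distinct vertices is a quad of some G^π, hence divisible by k. Taking b = o shows that
-- R is constant mod k along each row away from o, and as R is symmetric, R ≡ c (mod k)
-- on all edges avoiding o. Adding back c on those edges is again a coboundary (of the
-- half-integral vector equal to −c/2 at o and c/2 elsewhere), so G ≡ F (mod k) for a
-- coboundary F. Coboundaries have vanishing quads, so the quads of H = (G − F)/k are those
-- of G divided by k, and H is primitive. For k = 0, G = F and a single edge serves as H.

open import Data.Bool using (if_then_else_)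
open import Data.Empty using (⊥-elim)
open import Data.Fin using (Fin; _≟_)
open import Data.Fin.Permutation as Perm using (Permutation′; _⟨$⟩ʳ_; _∘ₚ_; transpose)
import Data.Fin.Permutation.Components as PC
open import Data.Integer using (ℤ; +_; _+_; _-_; _*_; -_; ∣_∣)
open import Data.Integer.Divisibility.Signed using (_∣_; divides; ∣ᵤ⇒∣; ∣m∣n⇒∣m+n)
open import Data.Integer.DivMod using (_%ℕ_; _/ℕ_; n%ℕd<d; a≡a%ℕn+[a/ℕn]*n)
import Data.Integer as ℤ using (NonZero)
import Data.Integer.Properties as ℤ
open import Data.Integer.Tactic.RingSolver using (solve-∀)
open import Data.List using (List; []; _∷_; length)
open import Data.List.Relation.Binary.Pointwise using (Pointwise; []; _∷_)
open import Data.List.Relation.Unary.All using (All; []; _∷_)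
open import Data.List.Relation.Unary.AllPairs using ([]; _∷_)
open import Data.List.Relation.Unary.Unique.Propositional using (Unique)
open import Data.List.Relation.Unary.Unique.Propositional.Properties using (map⁺)
open import Data.Nat using (ℕ; zero; suc; _≤_; s≤s; NonZero)
import Data.Nat as ℕ using (_*_)
import Data.Nat.Divisibility as ℕ
import Data.Nat.Properties as ℕ
open import Data.Product using (Σ; ∃; _×_; _,_; proj₁; proj₂)
open import Data.Sum using (_⊎_; inj₁; inj₂)
open import Function.Base using (_∘_)
open import Function.Bundles using (Injection)
open import Function.Properties.Inverse using (Inverse⇒Injection)
open import Relation.Binary.PropositionalEquality
open import Relation.Nullary using (yes; no; does)
open import Relation.Nullary.Decidable using (dec-true; dec-false)

open import Defs

parity : ∀ x → Even x ⊎ Odd x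
parity x with x %ℕ 2 | n%ℕd<d x 2 | a≡a%ℕn+[a/ℕn]*n x 2
... | 0           | _                 | x≡ = inj₁ (x /ℕ 2 , trans x≡ (even (x /ℕ 2)))
  where even : ∀ q → + 0 + q * + 2 ≡ + 2 * q
        even = solve-∀
... | 1           | _                 | x≡ = inj₂ (x /ℕ 2 , trans x≡ (odd (x /ℕ 2)))
  where odd : ∀ q → + 1 + q * + 2 ≡ + 2 * q + + 1
        odd = solve-∀
... | suc (suc _) | s≤s (s≤s ())      | _

Even-2*+ : ∀ q {c} → Even c → Even (+ 2 * q + c)
Even-2*+ q (a , refl) = q + a , shift q a
  where shift : ∀ q a → + 2 * q + + 2 * a ≡ + 2 * (q + a)
        shift = solve-∀

Odd-2*+ : ∀ q {c} → Odd c → Odd (+ 2 * q + c)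
Odd-2*+ q (a , refl) = q + a , shift q a
  where shift : ∀ q a → + 2 * q + (+ 2 * a + + 1) ≡ + 2 * (q + a) + + 1
        shift = solve-∀

-- A record rather than a synonym for + k ∣ x - y, so that x and y stay inferable.
record _≡_mod_ (x y : ℤ) (k : ℕ) : Set where
  constructor congruent
  field divisible : + k ∣ x - y

≡⇒≡-mod : ∀ {x y} k → x ≡ y → x ≡ y mod k
≡⇒≡-mod {x} k refl = congruent (divides (+ 0) (ℤ.+-inverseʳ x))

quotient : ∀ {x y k} → x ≡ y mod k → ℤ
quotient = _∣_.quotient ∘ _≡_mod_.divisible

≡-mod⇒≡+* : ∀ {x y k} (x≡y : x ≡ y mod k) → x ≡ y + + k * quotient x≡y
≡-mod⇒≡+* {x} {y} {k} (congruent (divides q x-y≡qk)) = begin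
  x               ≡⟨ split x y ⟩
  y + (x - y)     ≡⟨ cong (λ z → y + z) x-y≡qk ⟩
  y + q * + k     ≡⟨ cong (λ z → y + z) (ℤ.*-comm q (+ k)) ⟩
  y + + k * q     ∎
  where
  open ≡-Reasoning
  split : ∀ x y → x ≡ y + (x - y)
  split = solve-∀

≡-mod-trans : ∀ {x y z k} → x ≡ y mod k → y ≡ z mod k → x ≡ z mod k
≡-mod-trans {x} {y} {z} (congruent x≡y) (congruent y≡z) =
  congruent (subst (_ ∣_) (telescope x y z) (∣m∣n⇒∣m+n x≡y y≡z))
  where telescope : ∀ x y z → (x - y) + (y - z) ≡ x - z
        telescope = solve-∀

module _ {n : ℕ} where

  transpose-matchˡ : (i j : Fin n) → PC.transpose i j i ≡ j
  transpose-matchˡ i j rewrite dec-true (i ≟ i) refl = refl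

  transpose-mismatch : {i j k : Fin n} → k ≢ i → k ≢ j → PC.transpose i j k ≡ k
  transpose-mismatch {i} {j} {k} k≢i k≢j rewrite dec-false (k ≟ i) k≢i | dec-false (k ≟ j) k≢j = refl

  permutation-injective : (π : Permutation′ n) {x y : Fin n} → π ⟨$⟩ʳ x ≡ π ⟨$⟩ʳ y → x ≡ y
  permutation-injective π = Injection.injective (Inverse⇒Injection π)

  -- Each new pair x ↦ y is added by post-composing with the transposition of π x and y,
  -- which does not move the images of the earlier points.
  permutation-mapping : {xs ys : List (Fin n)} → Unique xs → Unique ys → length xs ≡ length ys →
    ∃ λ π → Pointwise (λ x y → π ⟨$⟩ʳ x ≡ y) xs ys
  permutation-mapping {[]}    {[]}    _ _ _ = Perm.id , []
  permutation-mapping {[]}    {_ ∷ _} _ _ ()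
  permutation-mapping {_ ∷ _} {[]}    _ _ ()
  permutation-mapping {x ∷ xs} {y ∷ ys} (x∉xs ∷ xs!) (y∉ys ∷ ys!) eq
    with permutation-mapping xs! ys! (ℕ.suc-injective eq)
  ... | π , π[xs]≡ys = π′ , transpose-matchˡ (π ⟨$⟩ʳ x) y ∷ unmoved x∉xs y∉ys π[xs]≡ys
    where
    π′ : Permutation′ n
    π′ = π ∘ₚ transpose (π ⟨$⟩ʳ x) y

    unmoved : ∀ {xs′ ys′} → All (x ≢_) xs′ → All (y ≢_) ys′ →
      Pointwise (λ x′ y′ → π ⟨$⟩ʳ x′ ≡ y′) xs′ ys′ → Pointwise (λ x′ y′ → π′ ⟨$⟩ʳ x′ ≡ y′) xs′ ys′
    unmoved [] [] [] = []
    unmoved (x≢x′ ∷ x∉) (y≢y′ ∷ y∉) (refl ∷ rest) =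
      transpose-mismatch (λ e → x≢x′ (sym (permutation-injective π e))) (λ e → y≢y′ (sym e))
        ∷ unmoved x∉ y∉ rest

  -- quad 4≤n (M ^ π) is definitionally alternating M (π v1) (π v2) (π v3) (π v4).
  alternating : Matrix n → (a b c d : Fin n) → ℤ
  alternating M a b c d = M a c - M b c - M a d + M b d

  alternating-cong : {M N : Matrix n} → (∀ i j → M i j ≡ N i j) →
    ∀ a b c d → alternating M a b c d ≡ alternating N a b c d
  alternating-cong M≡N a b c d =
    cong₂ _+_ (cong₂ _-_ (cong₂ _-_ (M≡N a c) (M≡N b c)) (M≡N a d)) (M≡N b d)

  alternating-+* : (F H : Matrix n) (k : ℤ) → ∀ a b c d →
    alternating (λ i j → F i j + k * H i j) a b c d ≡ alternating F a b c d + k * alternating H a b c d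
  alternating-+* F H k a b c d = linear (F a c) (F b c) (F a d) (F b d) (H a c) (H b c) (H a d) (H b d) k
    where
    linear : ∀ fac fbc fad fbd hac hbc had hbd k →
      (fac + k * hac) - (fbc + k * hbc) - (fad + k * had) + (fbd + k * hbd)
        ≡ (fac - fbc - fad + fbd) + k * (hac - hbc - had + hbd)
    linear = solve-∀

  coboundary-isSignedMultigraph : {F : Matrix n} → IsCoboundary F → IsSignedMultigraph F
  coboundary-isSignedMultigraph {F} (g , _ , 2F≡ , F-diagonal) = symmetric , F-diagonal
    where
    symmetric : ∀ i j → F i j ≡ F j i
    symmetric i j with i ≟ j
    ... | yes refl = refl
    ... | no i≢j = ℤ.*-cancelˡ-≡ (+ 2) (F i j) (F j i)
      (trans (2F≡ i j i≢j) (trans (ℤ.+-comm (g i) (g j)) (sym (2F≡ j i (i≢j ∘ sym)))))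

  isSignedMultigraph-quotient : {G F H : Matrix n} (k : ℤ) .{{_ : ℤ.NonZero k}} →
    IsSignedMultigraph G → IsSignedMultigraph F → (∀ i j → G i j ≡ F i j + k * H i j) →
    IsSignedMultigraph H
  isSignedMultigraph-quotient {G} {F} {H} k (G-sym , G-diagonal) (F-sym , F-diagonal) G≡F+kH =
    (λ i j → ℤ.*-cancelˡ-≡ k _ _ (begin
      k * H i j      ≡⟨ kH≡G-F i j ⟩
      G i j - F i j  ≡⟨ cong₂ _-_ (G-sym i j) (F-sym i j) ⟩
      G j i - F j i  ≡⟨ kH≡G-F j i ⟨
      k * H j i      ∎)) ,
    (λ i → ℤ.*-cancelˡ-≡ k _ _ (begin
      k * H i i      ≡⟨ kH≡G-F i i ⟩
      G i i - F i i  ≡⟨ cong₂ _-_ (G-diagonal i) (F-diagonal i) ⟩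
      + 0            ≡⟨ ℤ.*-zeroʳ k ⟨
      k * + 0        ∎))
    where
    open ≡-Reasoning
    recover : ∀ y z → (y + z) - y ≡ z
    recover = solve-∀

    kH≡G-F : ∀ i j → k * H i j ≡ G i j - F i j
    kH≡G-F i j = trans (sym (recover (F i j) (k * H i j))) (cong (_- F i j) (sym (G≡F+kH i j)))

  alternating-coboundary : {F : Matrix n} {a b c d : Fin n} → IsCoboundary F →
    Unique (a ∷ b ∷ c ∷ d ∷ []) → alternating F a b c d ≡ + 0
  alternating-coboundary {F} {a} {b} {c} {d} (g , _ , 2F≡ , _)
    ((_ ∷ a≢c ∷ a≢d ∷ []) ∷ (b≢c ∷ b≢d ∷ []) ∷ _) =
    ℤ.*-cancelˡ-≡ (+ 2) _ _ (begin
      + 2 * alternating F a b c d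
        ≡⟨ distrib (F a c) (F b c) (F a d) (F b d) ⟩
      + 2 * F a c - + 2 * F b c - + 2 * F a d + + 2 * F b d
        ≡⟨ cong₂ _+_ (cong₂ _-_ (cong₂ _-_ (2F≡ a c a≢c) (2F≡ b c b≢c)) (2F≡ a d a≢d)) (2F≡ b d b≢d) ⟩
      (g a + g c) - (g b + g c) - (g a + g d) + (g b + g d)
        ≡⟨ cancel (g a) (g b) (g c) (g d) ⟩
      + 2 * + 0 ∎)
    where
    open ≡-Reasoning
    distrib : ∀ x y z w → + 2 * (x - y - z + w) ≡ + 2 * x - + 2 * y - + 2 * z + + 2 * w
    distrib = solve-∀
    cancel : ∀ a b c d → (a + c) - (b + c) - (a + d) + (b + d) ≡ + 2 * + 0
    cancel = solve-∀

  -- δ q c is the coboundary δf of the half-integral vector f = q + c/2.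
  δ : (Fin n → ℤ) → ℤ → Matrix n
  δ q c i j = if does (i ≟ j) then + 0 else q i + q j + c

  δ-diagonal : ∀ q c i → δ q c i i ≡ + 0
  δ-diagonal q c i rewrite dec-true (i ≟ i) refl = refl

  δ-offDiagonal : ∀ q c {i j} → i ≢ j → δ q c i j ≡ q i + q j + c
  δ-offDiagonal q c {i} {j} i≢j rewrite dec-false (i ≟ j) i≢j = refl

  δ-isCoboundary : ∀ q c → IsCoboundary (δ q c)
  δ-isCoboundary q c = (λ i → + 2 * q i + c) , uniformParity (parity c) , twice , δ-diagonal q c
    where
    uniformParity : Even c ⊎ Odd c →
      (∀ i → Even (+ 2 * q i + c)) ⊎ (∀ i → Odd (+ 2 * q i + c))
    uniformParity (inj₁ c-even) = inj₁ λ i → Even-2*+ (q i) c-even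
    uniformParity (inj₂ c-odd)  = inj₂ λ i → Odd-2*+ (q i) c-odd

    double : ∀ x y c → + 2 * (x + y + c) ≡ (+ 2 * x + c) + (+ 2 * y + c)
    double = solve-∀

    twice : ∀ i j → i ≢ j → + 2 * δ q c i j ≡ (+ 2 * q i + c) + (+ 2 * q j + c)
    twice i j i≢j rewrite δ-offDiagonal q c i≢j = double (q i) (q j) c

  indicator : Fin n → Fin n → ℤ
  indicator a i = if does (i ≟ a) then + 1 else + 0

  indicator-disjoint : {a b : Fin n} → a ≢ b → ∀ i → indicator a i * indicator b i ≡ + 0
  indicator-disjoint {a} {b} a≢b i with i ≟ a
  ... | no _ = refl
  ... | yes refl rewrite dec-false (i ≟ b) a≢b = refl

  edge : Fin n → Fin n → Matrix n
  edge a b i j = indicator a i * indicator b j + indicator b i * indicator a j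

  edge-isSignedMultigraph : {a b : Fin n} → a ≢ b → IsSignedMultigraph (edge a b)
  edge-isSignedMultigraph {a} {b} a≢b = symmetric , diagonal
    where
    swap : ∀ w x y z → w * x + y * z ≡ z * y + x * w
    swap = solve-∀

    symmetric : ∀ i j → edge a b i j ≡ edge a b j i
    symmetric i j = swap (indicator a i) (indicator b j) (indicator b i) (indicator a j)

    diagonal : ∀ i → edge a b i i ≡ + 0
    diagonal i = cong₂ _+_ (indicator-disjoint a≢b i)
      (trans (ℤ.*-comm (indicator b i) (indicator a i)) (indicator-disjoint a≢b i))

-- Matching 4≤n against s≤s⁴ makes the corners v1, …, v4 reduce to the numerals 0, …, 3.
corners-unique : ∀ {n} (4≤n : 4 ≤ n) → Unique (v1 4≤n ∷ v2 4≤n ∷ v3 4≤n ∷ v4 4≤n ∷ [])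
corners-unique (s≤s (s≤s (s≤s (s≤s _)))) =
  ((λ ()) ∷ (λ ()) ∷ (λ ()) ∷ []) ∷ ((λ ()) ∷ (λ ()) ∷ []) ∷ ((λ ()) ∷ []) ∷ [] ∷ []

v1≢v2 : ∀ {n} (4≤n : 4 ≤ n) → v1 4≤n ≢ v2 4≤n
v1≢v2 (s≤s (s≤s (s≤s (s≤s _)))) ()

v1≢v3 : ∀ {n} (4≤n : 4 ≤ n) → v1 4≤n ≢ v3 4≤n
v1≢v3 (s≤s (s≤s (s≤s (s≤s _)))) ()

v2≢v3 : ∀ {n} (4≤n : 4 ≤ n) → v2 4≤n ≢ v3 4≤n
v2≢v3 (s≤s (s≤s (s≤s (s≤s _)))) ()

quad-edge₁₃ : ∀ {n} (4≤n : 4 ≤ n) → quad 4≤n (edge (v1 4≤n) (v3 4≤n)) ≡ + 1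
quad-edge₁₃ (s≤s (s≤s (s≤s (s≤s _)))) = refl

module _ {n : ℕ} (4≤n : 4 ≤ n) where

  alternating-realised : {a b c d : Fin n} → Unique (a ∷ b ∷ c ∷ d ∷ []) → (M : Matrix n) →
    ∃ λ π → quad 4≤n (M ^ π) ≡ alternating M a b c d
  alternating-realised abcd! M with permutation-mapping (corners-unique 4≤n) abcd! refl
  ... | π , refl ∷ refl ∷ refl ∷ refl ∷ [] = π , refl

  quad-coboundary : {F : Matrix n} → IsCoboundary F → ∀ π → quad 4≤n (F ^ π) ≡ + 0
  quad-coboundary F-coboundary π =
    alternating-coboundary F-coboundary (map⁺ (permutation-injective π) (corners-unique 4≤n))

  edge₁₃-isPrimitive : IsPrimitive 4≤n (edge (v1 4≤n) (v3 4≤n))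
  edge₁₃-isPrimitive = (λ _ → ℕ.1∣ _) , λ d d∣quad → subst (d ℕ.∣_) (cong ∣_∣ (quad-edge₁₃ 4≤n)) (d∣quad Perm.id)

  -- A common divisor d of the quads of H gives the common divisor k d of the quads of G,
  -- so k d ∣ k.
  isPrimitive-quotient : {G H : Matrix n} {k : ℕ} .{{_ : NonZero k}} →
    (∀ π → quad 4≤n (G ^ π) ≡ + k * quad 4≤n (H ^ π)) →
    IsIndexOfPrimitivity 4≤n G k → IsPrimitive 4≤n H
  isPrimitive-quotient {k = k} G≡kH (_ , greatest) = (λ _ → ℕ.1∣ _) , λ d d∣H →
    ℕ.*-cancelˡ-∣ k (subst (k ℕ.* d ℕ.∣_) (sym (ℕ.*-identityʳ k))
      (greatest (k ℕ.* d) λ π →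
        subst (k ℕ.* d ℕ.∣_) (sym (trans (cong ∣_∣ (G≡kH π)) (ℤ.abs-* (+ k) _)))
          (ℕ.*-monoʳ-∣ k (d∣H π))))

  quad-+* : {G F H : Matrix n} {k : ℤ} → IsCoboundary F → (∀ i j → G i j ≡ F i j + k * H i j) →
    ∀ π → quad 4≤n (G ^ π) ≡ k * quad 4≤n (H ^ π)
  quad-+* {G} {F} {H} {k} F-coboundary G≡F+kH π = begin
    quad 4≤n (G ^ π)                               ≡⟨ alternating-cong G≡F+kH a b c d ⟩
    alternating (λ i j → F i j + k * H i j) a b c d ≡⟨ alternating-+* F H k a b c d ⟩
    quad 4≤n (F ^ π) + k * quad 4≤n (H ^ π)        ≡⟨ cong (_+ _) (quad-coboundary F-coboundary π) ⟩
    + 0 + k * quad 4≤n (H ^ π)                     ≡⟨ ℤ.+-identityˡ _ ⟩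
    k * quad 4≤n (H ^ π)                           ∎
    where
    open ≡-Reasoning
    a = π ⟨$⟩ʳ v1 4≤n
    b = π ⟨$⟩ʳ v2 4≤n
    c = π ⟨$⟩ʳ v3 4≤n
    d = π ⟨$⟩ʳ v4 4≤n

  quotient-decomposition : {G F : Matrix n} {k : ℕ} → IsSignedMultigraph G →
    IsIndexOfPrimitivity 4≤n G k → IsCoboundary F → (∀ i j → G i j ≡ F i j mod k) →
    Σ (Matrix n) λ H → IsSignedMultigraph H × IsPrimitive 4≤n H × (∀ i j → G i j ≡ F i j + + k * H i j)
  -- For k = 0 any primitive H works: + 0 * x reduces to + 0, so ≡-mod⇒≡+* gives the equation.
  quotient-decomposition {k = zero} _ _ _ G≡F =
    edge (v1 4≤n) (v3 4≤n) , edge-isSignedMultigraph (v1≢v3 4≤n) , edge₁₃-isPrimitive ,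
    λ i j → ≡-mod⇒≡+* (G≡F i j)
  quotient-decomposition {G} {F} {k@(suc _)} G-multigraph G-index F-coboundary G≡F =
    H ,
    isSignedMultigraph-quotient (+ k) G-multigraph (coboundary-isSignedMultigraph F-coboundary) G≡F+kH ,
    isPrimitive-quotient {G} {H} (quad-+* {G} {F} {H} {+ k} F-coboundary G≡F+kH) G-index ,
    G≡F+kH
    where
    H : Matrix n
    H i j = quotient (G≡F i j)

    G≡F+kH : ∀ i j → G i j ≡ F i j + + k * H i j
    G≡F+kH i j = ≡-mod⇒≡+* (G≡F i j)

module _ {n : ℕ} (4≤n : 4 ≤ n) {G : Matrix n} (G-multigraph : IsSignedMultigraph G)
         {k : ℕ} (G-index : IsIndexOfPrimitivity 4≤n G k) where

  private
    o p r : Fin n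
    o = v1 4≤n
    p = v2 4≤n
    r = v3 4≤n

    p≢o : p ≢ o
    p≢o = v1≢v2 4≤n ∘ sym

    r≢o : r ≢ o
    r≢o = v1≢v3 4≤n ∘ sym

    p≢r : p ≢ r
    p≢r = v2≢v3 4≤n

  alternating-divisible : {a b c d : Fin n} → Unique (a ∷ b ∷ c ∷ d ∷ []) → + k ∣ alternating G a b c d
  alternating-divisible abcd! with alternating-realised 4≤n abcd! G
  ... | π , quad≡ = subst (+ k ∣_) quad≡ (∣ᵤ⇒∣ (proj₁ G-index π))

  residual : Fin n → Fin n → ℤ
  residual i j = G i j - G o i - G o j

  residual-sym : ∀ i j → residual i j ≡ residual j i
  residual-sym i j rewrite proj₁ G-multigraph i j = swap (G j i) (G o i) (G o j)
    where swap : ∀ x y z → x - y - z ≡ x - z - y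
          swap = solve-∀

  residual-row : {x j l : Fin n} → x ≢ o → j ≢ o → l ≢ o → x ≢ j → x ≢ l →
    residual x j ≡ residual x l mod k
  residual-row {x} {j} {l} x≢o j≢o l≢o x≢j x≢l with j ≟ l
  ... | yes refl = ≡⇒≡-mod k refl
  ... | no j≢l = congruent (subst (+ k ∣_) (rows (G x j) (G o x) (G o j) (G x l) (G o l))
    (alternating-divisible
      ((x≢o ∷ x≢j ∷ x≢l ∷ []) ∷ ((j≢o ∘ sym) ∷ (l≢o ∘ sym) ∷ []) ∷ (j≢l ∷ []) ∷ [] ∷ [])))
    where rows : ∀ xj ox oj xl ol → xj - oj - xl + ol ≡ (xj - ox - oj) - (xl - ox - ol)
          rows = solve-∀

  -- Walk from the edge {i, j} to {p, r} through edges sharing a vertex: i j, i r, r p.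
  residual-constant : {i j : Fin n} → i ≢ o → j ≢ o → i ≢ j → residual i j ≡ residual p r mod k
  residual-constant {i} {j} i≢o j≢o i≢j with i ≟ r
  ... | yes refl = ≡-mod-trans (residual-row r≢o j≢o p≢o i≢j (p≢r ∘ sym)) (≡⇒≡-mod k (residual-sym r p))
  ... | no i≢r = ≡-mod-trans (residual-row i≢o j≢o r≢o i≢j i≢r)
    (≡-mod-trans (≡⇒≡-mod k (residual-sym i r))
    (≡-mod-trans (residual-row r≢o i≢o p≢o (i≢r ∘ sym) (p≢r ∘ sym)) (≡⇒≡-mod k (residual-sym r p))))

  common-residual : ℤ
  common-residual = residual p r

  -- Chosen so that δ potential common-residual agrees with G on the row of o.
  potential : Fin n → ℤ
  potential i = if does (i ≟ o) then - common-residual else G o i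

  congruent-offDiagonal : ∀ {i j} → i ≢ j → G i j ≡ potential i + potential j + common-residual mod k
  congruent-offDiagonal {i} {j} i≢j with i ≟ o | j ≟ o
  ... | yes refl | yes refl = ⊥-elim (i≢j refl)
  ... | yes refl | no j≢o =
    ≡⇒≡-mod k (cancel (G o j) common-residual)
    where cancel : ∀ x c → x ≡ - c + x + c
          cancel = solve-∀
  ... | no i≢o | yes refl =
    ≡⇒≡-mod k (trans (proj₁ G-multigraph i o) (cancel (G o i) common-residual))
    where cancel : ∀ x c → x ≡ x + - c + c
          cancel = solve-∀
  ... | no i≢o | no j≢o =
    congruent (subst (+ k ∣_) (regroup (G i j) (G o i) (G o j) common-residual)
      (_≡_mod_.divisible (residual-constant i≢o j≢o i≢j)))
    where regroup : ∀ x y z c → x - y - z - c ≡ x - (y + z + c)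
          regroup = solve-∀

  congruent-coboundary : ∀ i j → G i j ≡ δ potential common-residual i j mod k
  congruent-coboundary i j with i ≟ j
  ... | yes refl = ≡⇒≡-mod k (proj₂ G-multigraph i)
  ... | no i≢j = congruent-offDiagonal i≢j

  coboundary-approximation : Σ (Matrix n) λ F → IsCoboundary F × (∀ i j → G i j ≡ F i j mod k)
  coboundary-approximation =
    δ potential common-residual , δ-isCoboundary potential common-residual , congruent-coboundary

lemma3p2 : (n : ℕ) (4≤n : 4 ≤ n) (G : Matrix n) → IsSignedMultigraph G →
    (k : ℕ) → IsIndexOfPrimitivity 4≤n G k →
    Σ (Matrix n) λ F → Σ (Matrix n) λ H →
      IsCoboundary F × IsSignedMultigraph H × IsPrimitive 4≤n H ×
      (∀ i j → G i j ≡ F i j + + k * H i j)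
lemma3p2 n 4≤n G G-multigraph k G-index =
  let F , F-coboundary , G≡F = coboundary-approximation 4≤n G-multigraph G-index
      H , H-multigraph , H-primitive , G≡F+kH =
        quotient-decomposition 4≤n G-multigraph G-index F-coboundary G≡F
  in F , H , F-coboundary , H-multigraph , H-primitive , G≡F+kH
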